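{- Let $G=(S,r)$ be a ranked set with $|S|=n$. Let $$S(G;u,v)=\sum_{A\subseteq S}u^{r(S)-r(A)}v^{|A|-r(A)}$$ be its corank-nullity generating function, and let $T(G;x,y)=S(G;x-1,y-1)$ be its Tutte polynomial. Write $T(G;x,y)=\sum_{i,j}b_{i,j}x^iy^j$. Then: (1) for every integer $k$ with $0\le k<n$, $$\sum_{i=0}^k\sum_{j=0}^{k-i}(-1)^j\binom{k-i}{j}b_{i,j}=0;$$ (2) for $k=n$, $$\sum_{i=0}^n\sum_{j=0}^{n-i}(-1)^j\binom{n-i}{j}b_{i,j}=(-1)^{n-r(S)}.$$
   Context: A ranked set is a pair $G=(S,r)$ where $S$ is a finite set and $r:2^S\to\mathbb{Z}$ is a function satisfying (R0) $r(\emptyset)=0$; (R1) $r(A)\le r(S)$ for all $A\subseteq S$; (R2) $r(A)\le|A|$ for all $A\subseteq S$. These conditions guarantee that $T(G;x,y)$ is a polynomial in $x,y$; $b_{i,j}$ denotes its coefficient of $x^iy^j$ (zero if no such term). -}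

module Defs where

open import Data.Nat as ℕ using (ℕ; zero; suc)
open import Data.Nat.Combinatorics using (_C_)
open import Data.Integer as ℤ using (ℤ; +_; -_; ∣_∣)
open import Data.Fin.Subset using (Subset; ⊤; ⊥; ∣_∣; inside; outside)
open import Data.Vec using (_∷_; [])
open import Data.List using (List; []; _∷_; map; _++_; foldr)
open import Relation.Binary.PropositionalEquality using (_≡_)

record RankedSet (n : ℕ) : Set where
  field
    r  : Subset n → ℤ
    R0 : r ⊥ ≡ + 0
    R1 : ∀ A → r A ℤ.≤ r ⊤
    R2 : ∀ A → r A ℤ.≤ + (Data.Fin.Subset.∣ A ∣)

allSubsets : (n : ℕ) → List (Subset n)
allSubsets zero = [] ∷ []
allSubsets (suc n) = map (inside ∷_) (allSubsets n) ++ map (outside ∷_) (allSubsets n)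

sumTo : ℕ → (ℕ → ℤ) → ℤ
sumTo zero f = f 0
sumTo (suc k) f = sumTo k f ℤ.+ f (suc k)

-- Bivariate polynomials with integer coefficients, represented by their
-- coefficient function: p i j = coefficient of x^i y^j.
Poly2 : Set
Poly2 = ℕ → ℕ → ℤ

0P : Poly2
0P _ _ = + 0

1P : Poly2
1P zero zero = + 1
1P _ _ = + 0

_+P_ : Poly2 → Poly2 → Poly2
(p +P q) i j = p i j ℤ.+ q i j

_*P_ : Poly2 → Poly2 → Poly2
(p *P q) i j = sumTo i (λ a → sumTo j (λ c → p a c ℤ.* q (i ℕ.∸ a) (j ℕ.∸ c)))

_^P_ : Poly2 → ℕ → Poly2
p ^P zero = 1P
p ^P suc m = p *P (p ^P m)

x-1 : Poly2
x-1 zero zero = - (+ 1)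
x-1 (suc zero) zero = + 1
x-1 _ _ = + 0

y-1 : Poly2
y-1 zero zero = - (+ 1)
y-1 zero (suc zero) = + 1
y-1 _ _ = + 0

-- The exponents are nonnegative integers by (R1),(R2); ℤ.∣_∣ converts them to ℕ
-- (it is the identity on nonnegative integers).
tutte : {n : ℕ} → RankedSet n → Poly2
tutte {n} G = foldr (λ A acc → term A +P acc) 0P (allSubsets n)
  where
    open RankedSet G
    term : Subset n → Poly2
    term A = (x-1 ^P ℤ.∣ r ⊤ ℤ.- r A ∣) *P (y-1 ^P ℤ.∣ + (Data.Fin.Subset.∣ A ∣) ℤ.- r A ∣)

b : {n : ℕ} → RankedSet n → ℕ → ℕ → ℤ
b G = tutte G

sgn : ℕ → ℤ
sgn j = (- (+ 1)) ℤ.^ j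

altSum : {n : ℕ} → RankedSet n → ℕ → ℤ
altSum G k = sumTo k (λ i → sumTo (k ℕ.∸ i) (λ j → sgn j ℤ.* (+ ((k ℕ.∸ i) C j)) ℤ.* b G i j))

-- Put G(t) = Σ_k altSum_k t^k. The k-th alternating sum is the t^k coefficient of
-- T(t, -t/(1-t)) / (1-t), and this substitution sends x - 1 to t - 1 and y - 1 to 1/(t - 1).
-- Hence a subset A contributes (t - 1)^(r(S) - |A|) / (1 - t) and
--   G(t) = Σ_{A ⊆ S} (t - 1)^(r(S) - |A|) / (1 - t) = t^n (t - 1)^(r(S) - n) / (1 - t),
-- whose coefficients vanish below t^n and equal (-1)^(n - r(S)) at t^n.
-- Instead of power series, multiplication by t - 1 is tracked as the difference operator Δ
-- on coefficient sequences, and the sum over subsets is peeled off one element at a time.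

module Submission where

open import Defs
open import Data.Nat as ℕ using (ℕ; zero; suc; _<_; _≤_; _∸_; z≤n; s≤s)
import Data.Nat.Properties as ℕP
open import Data.Nat.Combinatorics using (_C_; k>n⇒nCk≡0; nCk+nC[k+1]≡[n+1]C[k+1])
open import Data.Integer using (ℤ; +_; -_; -[1+_]; _+_; _-_; _*_; _⊖_; _^_)
import Data.Integer as ℤ
import Data.Integer.Properties as ℤP
open import Data.Integer.Tactic.RingSolver using (solve-∀)
open import Data.Fin.Subset using (Subset; ⊤; inside; outside; ∣_∣)
open import Data.List using (List; []; _∷_; map; _++_; foldr)
open import Data.Product using (_×_; _,_)
open import Data.Vec using (_∷_)
open import Function using (_∘_)
open import Relation.Binary.PropositionalEquality
  using (_≡_; refl; sym; trans; cong; cong₂; module ≡-Reasoning)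

sumTo-cong : ∀ k {f g : ℕ → ℤ} → (∀ i → i ≤ k → f i ≡ g i) → sumTo k f ≡ sumTo k g
sumTo-cong zero    f≗g = f≗g 0 z≤n
sumTo-cong (suc k) f≗g =
  cong₂ _+_ (sumTo-cong k (λ i i≤k → f≗g i (ℕP.m≤n⇒m≤1+n i≤k))) (f≗g (suc k) ℕP.≤-refl)

sumTo-shift : ∀ k (f : ℕ → ℤ) → sumTo (suc k) f ≡ f 0 + sumTo k (f ∘ suc)
sumTo-shift zero    f = refl
sumTo-shift (suc k) f =
  trans (cong (_+ f (suc (suc k))) (sumTo-shift k f)) (ℤP.+-assoc (f 0) _ _)

sumTo-+ : ∀ k (f g : ℕ → ℤ) → sumTo k (λ i → f i + g i) ≡ sumTo k f + sumTo k g
sumTo-+ zero    f g = refl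
sumTo-+ (suc k) f g =
  trans (cong (_+ (f (suc k) + g (suc k))) (sumTo-+ k f g)) (interchange (sumTo k f) (sumTo k g) (f (suc k)) (g (suc k)))
  where
  interchange : ∀ a b c d → (a + b) + (c + d) ≡ (a + c) + (b + d)
  interchange = solve-∀

sumTo-neg : ∀ k (f : ℕ → ℤ) → sumTo k (λ i → - f i) ≡ - sumTo k f
sumTo-neg zero    f = refl
sumTo-neg (suc k) f =
  trans (cong (_+ - f (suc k)) (sumTo-neg k f)) (sym (ℤP.neg-distrib-+ (sumTo k f) (f (suc k))))

sumTo-- : ∀ k (f g : ℕ → ℤ) → sumTo k (λ i → f i - g i) ≡ sumTo k f - sumTo k g
sumTo-- k f g = trans (sumTo-+ k f (λ i → - g i)) (cong (_+_ (sumTo k f)) (sumTo-neg k g))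

sumTo-zero : ∀ k {f : ℕ → ℤ} → (∀ i → f i ≡ + 0) → sumTo k f ≡ + 0
sumTo-zero zero    f≗0 = f≗0 0
sumTo-zero (suc k) f≗0 = cong₂ _+_ (sumTo-zero k f≗0) (f≗0 (suc k))

sumTo-head : ∀ k {f : ℕ → ℤ} → (∀ i → f (suc i) ≡ + 0) → sumTo k f ≡ f 0
sumTo-head zero    _   = refl
sumTo-head (suc k) {f} tail≗0 =
  trans (sumTo-shift k f) (trans (cong (_+_ (f 0)) (sumTo-zero k tail≗0)) (ℤP.+-identityʳ (f 0)))

sumTo-last : ∀ k {f : ℕ → ℤ} → (∀ i → i < k → f i ≡ + 0) → sumTo k f ≡ f k
sumTo-last zero    _   = refl
sumTo-last (suc k) {f} init≗0 =
  trans (cong (_+ f (suc k)) (trans (sumTo-last k (λ i i<k → init≗0 i (ℕP.m<n⇒m<1+n i<k)))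
                                    (init≗0 k (ℕP.n<1+n k))))
        (ℤP.+-identityˡ (f (suc k)))

-- Coefficients of (t - 1) f(t) in terms of those of f(t).
Δ : (ℕ → ℤ) → ℕ → ℤ
Δ f zero    = - f 0
Δ f (suc i) = f i - f (suc i)

Δ-cong : ∀ {f g : ℕ → ℤ} → (∀ i → f i ≡ g i) → ∀ i → Δ f i ≡ Δ g i
Δ-cong f≗g zero    = cong -_ (f≗g 0)
Δ-cong f≗g (suc i) = cong₂ _-_ (f≗g i) (f≗g (suc i))

Δ-vanishes : ∀ {f : ℕ → ℤ} → (∀ i → f i ≡ + 0) → ∀ i → Δ f i ≡ + 0
Δ-vanishes f≗0 zero    = cong -_ (f≗0 0)
Δ-vanishes f≗0 (suc i) = cong₂ _-_ (f≗0 i) (f≗0 (suc i))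

Δ-*ʳ : ∀ (f : ℕ → ℤ) z i → Δ f i * z ≡ Δ (λ i′ → f i′ * z) i
Δ-*ʳ f z zero    = sym (ℤP.neg-distribˡ-* (f 0) z)
Δ-*ʳ f z (suc i) = distrib (f i) (f (suc i)) z
  where
  distrib : ∀ x y z → (x - y) * z ≡ x * z - y * z
  distrib = solve-∀

Δ-*ˡ : ∀ z (f : ℕ → ℤ) i → z * Δ f i ≡ Δ (λ i′ → z * f i′) i
Δ-*ˡ z f zero    = sym (ℤP.neg-distribʳ-* z (f 0))
Δ-*ˡ z f (suc i) = distrib z (f i) (f (suc i))
  where
  distrib : ∀ z x y → z * (x - y) ≡ z * x - z * y
  distrib = solve-∀

convolve-t-1 : ∀ (e : ℕ → ℤ) → e 0 ≡ - + 1 → e 1 ≡ + 1 → (∀ a → e (suc (suc a)) ≡ + 0) →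
               ∀ (q : ℕ → ℤ) i → sumTo i (λ a → e a * q (i ∸ a)) ≡ Δ q i
convolve-t-1 e e₀ e₁ e₂₊ q zero =
  trans (cong (_* q 0) e₀) (ℤP.-1*i≡-i (q 0))
convolve-t-1 e e₀ e₁ e₂₊ q (suc i) = begin
  sumTo (suc i) (λ a → e a * q (suc i ∸ a))
    ≡⟨ sumTo-shift i _ ⟩
  e 0 * q (suc i) + sumTo i (λ a → e (suc a) * q (i ∸ a))
    ≡⟨ cong₂ _+_ (trans (cong (_* q (suc i)) e₀) (ℤP.-1*i≡-i (q (suc i))))
                 (sumTo-head i (λ a → trans (cong (_* q (i ∸ suc a)) (e₂₊ a)) (ℤP.*-zeroˡ (q (i ∸ suc a))))) ⟩
  - q (suc i) + e 1 * q i
    ≡⟨ cong (λ c → - q (suc i) + c * q i) e₁ ⟩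
  - q (suc i) + + 1 * q i
    ≡⟨ swap (q i) (q (suc i)) ⟩
  q i - q (suc i) ∎
  where
  open ≡-Reasoning
  swap : ∀ x y → - y + + 1 * x ≡ x - y
  swap = solve-∀

mulX-1 : Poly2 → Poly2
mulX-1 p i j = Δ (λ i′ → p i′ j) i

mulY-1 : Poly2 → Poly2
mulY-1 p i = Δ (p i)

x-1-y-free : ∀ a c → x-1 a (suc c) ≡ + 0
x-1-y-free zero          c = refl
x-1-y-free (suc zero)    c = refl
x-1-y-free (suc (suc a)) c = refl

x-1-*P : ∀ q i j → (x-1 *P q) i j ≡ mulX-1 q i j
x-1-*P q i j =
  trans (sumTo-cong i (λ a _ → sumTo-head j (λ c →
           trans (cong (_* q (i ∸ a) (j ∸ suc c)) (x-1-y-free a c)) (ℤP.*-zeroˡ (q (i ∸ a) (j ∸ suc c))))))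
        (convolve-t-1 (λ a → x-1 a 0) refl refl (λ _ → refl) (λ a → q a j) i)

y-1-*P : ∀ q i j → (y-1 *P q) i j ≡ mulY-1 q i j
y-1-*P q i j =
  trans (sumTo-head i (λ a → sumTo-zero j (λ c → ℤP.*-zeroˡ (q (i ∸ suc a) (j ∸ c)))))
        (convolve-t-1 (y-1 0) refl refl (λ _ → refl) (q i) j)

x-1^P-y-free : ∀ a i j → (x-1 ^P a) i (suc j) ≡ + 0
x-1^P-y-free zero    zero    j = refl
x-1^P-y-free zero    (suc i) j = refl
x-1^P-y-free (suc a) i       j =
  trans (x-1-*P (x-1 ^P a) i (suc j)) (Δ-vanishes (λ i′ → x-1^P-y-free a i′ j) i)

y-1^P-x-free : ∀ c i j → (y-1 ^P c) (suc i) j ≡ + 0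
y-1^P-x-free zero    i zero    = refl
y-1^P-x-free zero    i (suc j) = refl
y-1^P-x-free (suc c) i j       =
  trans (y-1-*P (y-1 ^P c) (suc i) j) (Δ-vanishes (y-1^P-x-free c i) j)

*P-separated : ∀ p q → (∀ a c → p a (suc c) ≡ + 0) → (∀ a c → q (suc a) c ≡ + 0) →
               ∀ i j → (p *P q) i j ≡ p i 0 * q 0 j
*P-separated p q p-y-free q-x-free i j =
  trans (sumTo-cong i (λ a _ → sumTo-head j (λ c →
           trans (cong (_* q (i ∸ a) (j ∸ suc c)) (p-y-free a c)) (ℤP.*-zeroˡ (q (i ∸ a) (j ∸ suc c))))))
        (trans (sumTo-last i below) (cong (λ m → p i 0 * q m j) (ℕP.n∸n≡0 i)))
  where
  beyond-row-0 : ∀ i a → a < i → q (i ∸ a) j ≡ + 0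
  beyond-row-0 (suc i) zero    _         = q-x-free i j
  beyond-row-0 (suc i) (suc a) (s≤s a<i) = beyond-row-0 i a a<i
  below : ∀ a → a < i → p a 0 * q (i ∸ a) j ≡ + 0
  below a a<i = trans (cong (p a 0 *_) (beyond-row-0 i a a<i)) (ℤP.*-zeroʳ (p a 0))

monomial : ℕ → ℕ → Poly2
monomial a c = (x-1 ^P a) *P (y-1 ^P c)

monomial-separated : ∀ a c i j → monomial a c i j ≡ (x-1 ^P a) i 0 * (y-1 ^P c) 0 j
monomial-separated a c = *P-separated (x-1 ^P a) (y-1 ^P c) (x-1^P-y-free a) (y-1^P-x-free c)

monomial-sucˡ : ∀ a c i j → monomial (suc a) c i j ≡ mulX-1 (monomial a c) i j
monomial-sucˡ a c i j = begin
  monomial (suc a) c i j                            ≡⟨ monomial-separated (suc a) c i j ⟩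
  (x-1 *P (x-1 ^P a)) i 0 * (y-1 ^P c) 0 j         ≡⟨ cong (_* (y-1 ^P c) 0 j) (x-1-*P (x-1 ^P a) i 0) ⟩
  Δ (λ i′ → (x-1 ^P a) i′ 0) i * (y-1 ^P c) 0 j     ≡⟨ Δ-*ʳ (λ i′ → (x-1 ^P a) i′ 0) ((y-1 ^P c) 0 j) i ⟩
  Δ (λ i′ → (x-1 ^P a) i′ 0 * (y-1 ^P c) 0 j) i     ≡⟨ Δ-cong (λ i′ → sym (monomial-separated a c i′ j)) i ⟩
  mulX-1 (monomial a c) i j                         ∎
  where open ≡-Reasoning

monomial-sucʳ : ∀ a c i j → monomial a (suc c) i j ≡ mulY-1 (monomial a c) i j
monomial-sucʳ a c i j = begin
  monomial a (suc c) i j                            ≡⟨ monomial-separated a (suc c) i j ⟩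
  (x-1 ^P a) i 0 * (y-1 *P (y-1 ^P c)) 0 j         ≡⟨ cong ((x-1 ^P a) i 0 *_) (y-1-*P (y-1 ^P c) 0 j) ⟩
  (x-1 ^P a) i 0 * Δ ((y-1 ^P c) 0) j               ≡⟨ Δ-*ˡ ((x-1 ^P a) i 0) ((y-1 ^P c) 0) j ⟩
  Δ (λ j′ → (x-1 ^P a) i 0 * (y-1 ^P c) 0 j′) j     ≡⟨ Δ-cong (λ j′ → sym (monomial-separated a c i j′)) j ⟩
  mulY-1 (monomial a c) i j                         ∎
  where open ≡-Reasoning

signedBinomial : ℕ → ℕ → ℤ
signedBinomial m j = sgn j * + (m C j)

signedBinomial-suc : ∀ m j →
  signedBinomial (suc m) (suc j) ≡ signedBinomial m (suc j) - signedBinomial m j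
signedBinomial-suc m j = begin
  sgn (suc j) * + (suc m C suc j)               ≡⟨ cong (λ n → sgn (suc j) * + n) (sym (nCk+nC[k+1]≡[n+1]C[k+1] m j)) ⟩
  sgn (suc j) * + (m C j ℕ.+ m C suc j)         ≡⟨ cong (sgn (suc j) *_) (ℤP.pos-+ (m C j) (m C suc j)) ⟩
  - + 1 * sgn j * (+ (m C j) + + (m C suc j))   ≡⟨ expand (sgn j) (+ (m C j)) (+ (m C suc j)) ⟩
  - + 1 * sgn j * + (m C suc j) - sgn j * + (m C j) ∎
  where
  open ≡-Reasoning
  expand : ∀ s x y → - + 1 * s * (x + y) ≡ - + 1 * s * y - s * x
  expand = solve-∀

-- row m q is the coefficient of s^m in q(-s/(1-s)) / (1-s).
row : ℕ → (ℕ → ℤ) → ℤ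
row m q = sumTo m (λ j → signedBinomial m j * q j)

row-cong : ∀ m {q q′ : ℕ → ℤ} → (∀ j → q j ≡ q′ j) → row m q ≡ row m q′
row-cong m q≗q′ = sumTo-cong m (λ j _ → cong (signedBinomial m j *_) (q≗q′ j))

row-+ : ∀ m (q q′ : ℕ → ℤ) → row m (λ j → q j + q′ j) ≡ row m q + row m q′
row-+ m q q′ =
  trans (sumTo-cong m (λ j _ → ℤP.*-distribˡ-+ (signedBinomial m j) (q j) (q′ j)))
        (sumTo-+ m _ _)

row-neg : ∀ m (q : ℕ → ℤ) → row m (λ j → - q j) ≡ - row m q
row-neg m q =
  trans (sumTo-cong m (λ j _ → sym (ℤP.neg-distribʳ-* (signedBinomial m j) (q j))))
        (sumTo-neg m _)

row-- : ∀ m (q q′ : ℕ → ℤ) → row m (λ j → q j - q′ j) ≡ row m q - row m q′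
row-- m q q′ = trans (row-+ m q (λ j → - q′ j)) (cong (_+_ (row m q)) (row-neg m q′))

row-extend : ∀ m (q : ℕ → ℤ) → sumTo (suc m) (λ j → signedBinomial m j * q j) ≡ row m q
row-extend m q = begin
  row m q + sgn (suc m) * + (m C suc m) * q (suc m)
    ≡⟨ cong (λ n → row m q + sgn (suc m) * + n * q (suc m)) (k>n⇒nCk≡0 (ℕP.n<1+n m)) ⟩
  row m q + sgn (suc m) * + 0 * q (suc m)
    ≡⟨ cong (λ z → row m q + z * q (suc m)) (ℤP.*-zeroʳ (sgn (suc m))) ⟩
  row m q + + 0
    ≡⟨ ℤP.+-identityʳ (row m q) ⟩
  row m q ∎
  where open ≡-Reasoning

row-pascal : ∀ m (q : ℕ → ℤ) → row (suc m) q ≡ row m q - row m (q ∘ suc)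
row-pascal m q = begin
  row (suc m) q
    ≡⟨ sumTo-shift m _ ⟩
  q₀ + sumTo m (λ j → signedBinomial (suc m) (suc j) * q (suc j))
    ≡⟨ cong (_+_ q₀) (sumTo-cong m (λ j _ → trans (cong (_* q (suc j)) (signedBinomial-suc m j))
                                                 (distrib (signedBinomial m (suc j)) (signedBinomial m j) (q (suc j))))) ⟩
  q₀ + sumTo m (λ j → signedBinomial m (suc j) * q (suc j) - signedBinomial m j * q (suc j))
    ≡⟨ cong (_+_ q₀) (sumTo-- m _ _) ⟩
  q₀ + (sumTo m (λ j → signedBinomial m (suc j) * q (suc j)) - row m (q ∘ suc))
    ≡⟨ ℤP.+-assoc q₀ _ _ ⟨
  q₀ + sumTo m (λ j → signedBinomial m (suc j) * q (suc j)) - row m (q ∘ suc)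
    ≡⟨ cong (_- row m (q ∘ suc)) (trans (sym (sumTo-shift m (λ j → signedBinomial m j * q j))) (row-extend m q)) ⟩
  row m q - row m (q ∘ suc) ∎
  where
  open ≡-Reasoning
  q₀ = signedBinomial m 0 * q 0
  distrib : ∀ x y z → (x - y) * z ≡ x * z - y * z
  distrib = solve-∀

Δ-row-Δ : ∀ (q : ℕ → ℤ) m → Δ (λ m′ → row m′ (Δ q)) m ≡ row m q
Δ-row-Δ q zero    = cancel (q 0)
  where
  cancel : ∀ x → - (+ 1 * - x) ≡ + 1 * x
  cancel = solve-∀
Δ-row-Δ q (suc m) = begin
  row m (Δ q) - row (suc m) (Δ q)                   ≡⟨ cong (_-_ (row m (Δ q))) (row-pascal m (Δ q)) ⟩
  row m (Δ q) - (row m (Δ q) - row m (Δ q ∘ suc))   ≡⟨ cancel (row m (Δ q)) (row m (Δ q ∘ suc)) ⟩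
  row m (λ j → q j - q (suc j))                     ≡⟨ row-- m q (q ∘ suc) ⟩
  row m q - row m (q ∘ suc)                         ≡⟨ row-pascal m q ⟨
  row (suc m) q                                     ∎
  where
  open ≡-Reasoning
  cancel : ∀ x y → x - (x - y) ≡ y
  cancel = solve-∀

row-Δ : ∀ m (P : ℕ → ℕ → ℤ) i → row m (λ j → Δ (λ i′ → P i′ j) i) ≡ Δ (λ i′ → row m (P i′)) i
row-Δ m P zero    = row-neg m (P 0)
row-Δ m P (suc i) = row-- m (P i) (P (suc i))

-- The t^k coefficient of a product Σ_i t^i F_i(t).
conv : ℕ → (ℕ → ℕ → ℤ) → ℤ
conv k F = sumTo k (λ i → F i (k ∸ i))

conv-cong : ∀ k {F G : ℕ → ℕ → ℤ} → (∀ i m → F i m ≡ G i m) → conv k F ≡ conv k G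
conv-cong k F≗G = sumTo-cong k (λ i _ → F≗G i (k ∸ i))

conv-Δˡ : ∀ (F : ℕ → ℕ → ℤ) k → conv k (λ i m → Δ (λ i′ → F i′ m) i) ≡ Δ (λ k′ → conv k′ F) k
conv-Δˡ F zero    = refl
conv-Δˡ F (suc k) = begin
  conv (suc k) (λ i m → Δ (λ i′ → F i′ m) i)
    ≡⟨ sumTo-shift k _ ⟩
  - F 0 (suc k) + sumTo k (λ i → F i (k ∸ i) - F (suc i) (k ∸ i))
    ≡⟨ cong (_+_ (- F 0 (suc k))) (sumTo-- k _ _) ⟩
  - F 0 (suc k) + (conv k F - rest)
    ≡⟨ rearrange (F 0 (suc k)) (conv k F) rest ⟩
  conv k F - (F 0 (suc k) + rest)
    ≡⟨ cong (_-_ (conv k F)) (sumTo-shift k (λ i → F i (suc k ∸ i))) ⟨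
  conv k F - conv (suc k) F ∎
  where
  open ≡-Reasoning
  rest = sumTo k (λ i → F (suc i) (k ∸ i))
  rearrange : ∀ f c r → - f + (c - r) ≡ c - (f + r)
  rearrange = solve-∀

conv-Δʳ : ∀ (F : ℕ → ℕ → ℤ) k → conv k (λ i → Δ (F i)) ≡ Δ (λ k′ → conv k′ F) k
conv-Δʳ F zero    = refl
conv-Δʳ F (suc k) = begin
  sumTo k (λ i → Δ (F i) (suc k ∸ i)) + Δ (F (suc k)) (k ∸ k)
    ≡⟨ cong₂ _+_ (sumTo-cong k (λ i i≤k → cong (Δ (F i)) (suc-∸ i≤k)))
                 (cong (Δ (F (suc k))) (ℕP.n∸n≡0 k)) ⟩
  sumTo k (λ i → F i (k ∸ i) - F i (suc (k ∸ i))) + - F (suc k) 0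
    ≡⟨ cong (_+ - F (suc k) 0) (sumTo-- k _ _) ⟩
  conv k F - rest + - F (suc k) 0
    ≡⟨ rearrange (conv k F) rest (F (suc k) 0) ⟩
  conv k F - (rest + F (suc k) 0)
    ≡⟨ cong (_-_ (conv k F)) (cong₂ _+_ (sumTo-cong k (λ i i≤k → cong (F i) (suc-∸ i≤k)))
                                        (cong (F (suc k)) (ℕP.n∸n≡0 k))) ⟨
  conv k F - conv (suc k) F ∎
  where
  open ≡-Reasoning
  rest = sumTo k (λ i → F i (suc (k ∸ i)))
  suc-∸ : ∀ {i} → i ≤ k → suc k ∸ i ≡ suc (k ∸ i)
  suc-∸ = ℕP.+-∸-assoc 1
  rearrange : ∀ c r f → c - r + - f ≡ c - (r + f)
  rearrange = solve-∀

-- alt k p is the coefficient of t^k in p(t, -t/(1-t)) / (1-t); altSum G k unfolds to alt k (tutte G).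
alt : ℕ → Poly2 → ℤ
alt k p = conv k (λ i m → row m (p i))

alt-cong : ∀ k {p q : Poly2} → (∀ i j → p i j ≡ q i j) → alt k p ≡ alt k q
alt-cong k p≗q = conv-cong k (λ i m → row-cong m (p≗q i))

alt-+P : ∀ k (p q : Poly2) → alt k (p +P q) ≡ alt k p + alt k q
alt-+P k p q = trans (conv-cong k (λ i m → row-+ m (p i) (q i))) (sumTo-+ k _ _)

alt-0P : ∀ k → alt k 0P ≡ + 0
alt-0P k = sumTo-zero k (λ i → sumTo-zero (k ∸ i) (λ j → ℤP.*-zeroʳ (signedBinomial (k ∸ i) j)))

alt-mulX-1 : ∀ k (p : Poly2) → alt k (mulX-1 p) ≡ Δ (λ k′ → alt k′ p) k
alt-mulX-1 k p = trans (conv-cong k (λ i m → row-Δ m p i)) (conv-Δˡ (λ i m → row m (p i)) k)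

Δ-alt-mulY-1 : ∀ k (p : Poly2) → Δ (λ k′ → alt k′ (mulY-1 p)) k ≡ alt k p
Δ-alt-mulY-1 k p =
  trans (sym (conv-Δʳ (λ i m → row m (Δ (p i))) k)) (conv-cong k (λ i → Δ-row-Δ (p i)))

alt-monomial-sucˡ : ∀ k a c → alt k (monomial (suc a) c) ≡ Δ (λ k′ → alt k′ (monomial a c)) k
alt-monomial-sucˡ k a c = trans (alt-cong k (monomial-sucˡ a c)) (alt-mulX-1 k (monomial a c))

Δ-alt-monomial-sucʳ : ∀ k a c → Δ (λ k′ → alt k′ (monomial a (suc c))) k ≡ alt k (monomial a c)
Δ-alt-monomial-sucʳ k a c =
  trans (Δ-cong (λ k′ → alt-cong k′ (monomial-sucʳ a c)) k) (Δ-alt-mulY-1 k (monomial a c))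

alt-monomial-suc-suc : ∀ k a c → alt k (monomial (suc a) (suc c)) ≡ alt k (monomial a c)
alt-monomial-suc-suc k a c =
  trans (alt-monomial-sucˡ k a (suc c)) (Δ-alt-monomial-sucʳ k a c)

-- ν k d is the coefficient of t^k in (t - 1)^d / (1 - t).
ν : ℕ → ℤ → ℤ
ν k (+ a)    = alt k (monomial a 0)
ν k -[1+ c ] = alt k (monomial 0 (suc c))

alt-monomial : ∀ k a c → alt k (monomial a c) ≡ ν k (a ⊖ c)
alt-monomial k zero    zero    = refl
alt-monomial k (suc a) zero    = refl
alt-monomial k zero    (suc c) = refl
alt-monomial k (suc a) (suc c) =
  trans (alt-monomial-suc-suc k a c)
        (trans (alt-monomial k a c) (cong (ν k) (sym (ℤP.[1+m]⊖[1+n]≡m⊖n a c))))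

ν-suc : ∀ k d → ν k (+ 1 + d) ≡ Δ (λ k′ → ν k′ d) k
ν-suc k (+ a)    = alt-monomial-sucˡ k a 0
ν-suc k -[1+ c ] = trans (sym (alt-monomial k 1 (suc c))) (alt-monomial-sucˡ k 0 (suc c))

ν-pair-suc : ∀ k d → ν (suc k) d + ν (suc k) (+ 1 + d) ≡ ν k d
ν-pair-suc k d = trans (cong (_+_ (ν (suc k) d)) (ν-suc (suc k) d)) (cancel (ν (suc k) d) (ν k d))
  where
  cancel : ∀ x y → x + (y - x) ≡ y
  cancel = solve-∀

ν-pair-zero : ∀ d → ν 0 d + ν 0 (+ 1 + d) ≡ + 0
ν-pair-zero d = trans (cong (_+_ (ν 0 d)) (ν-suc 0 d)) (ℤP.+-inverseʳ (ν 0 d))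

ν-zero : ∀ d → ν 0 d ≡ sgn ℤ.∣ d ∣
ν-zero (+ zero)       = refl
ν-zero (+ suc a)      = trans (ν-suc 0 (+ a)) (trans (cong -_ (ν-zero (+ a))) (sym (ℤP.-1*i≡-i (sgn a))))
ν-zero -[1+ zero ]    = refl
ν-zero -[1+ suc c ]   = begin
  ν 0 -[1+ suc c ]               ≡⟨ ℤP.neg-involutive (ν 0 -[1+ suc c ]) ⟨
  - - ν 0 -[1+ suc c ]           ≡⟨ cong -_ (ν-suc 0 -[1+ suc c ]) ⟨
  - ν 0 -[1+ c ]                 ≡⟨ cong -_ (ν-zero -[1+ c ]) ⟩
  - sgn (suc c)                  ≡⟨ ℤP.-1*i≡-i (sgn (suc c)) ⟨
  sgn (suc (suc c))              ∎
  where open ≡-Reasoning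

sumOver : {A : Set} → List A → (A → ℤ) → ℤ
sumOver xs f = foldr (λ x acc → f x + acc) (+ 0) xs

module _ {A : Set} where

  sumOver-cong : ∀ (xs : List A) {f g : A → ℤ} → (∀ x → f x ≡ g x) → sumOver xs f ≡ sumOver xs g
  sumOver-cong []       f≗g = refl
  sumOver-cong (x ∷ xs) f≗g = cong₂ _+_ (f≗g x) (sumOver-cong xs f≗g)

  sumOver-zero : ∀ (xs : List A) {f : A → ℤ} → (∀ x → f x ≡ + 0) → sumOver xs f ≡ + 0
  sumOver-zero []       f≗0 = refl
  sumOver-zero (x ∷ xs) f≗0 = cong₂ _+_ (f≗0 x) (sumOver-zero xs f≗0)

  sumOver-++ : ∀ (xs ys : List A) f → sumOver (xs ++ ys) f ≡ sumOver xs f + sumOver ys f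
  sumOver-++ []       ys f = sym (ℤP.+-identityˡ (sumOver ys f))
  sumOver-++ (x ∷ xs) ys f =
    trans (cong (_+_ (f x)) (sumOver-++ xs ys f)) (sym (ℤP.+-assoc (f x) _ _))

  sumOver-+ : ∀ (xs : List A) f g → sumOver xs (λ x → f x + g x) ≡ sumOver xs f + sumOver xs g
  sumOver-+ []       f g = refl
  sumOver-+ (x ∷ xs) f g =
    trans (cong (_+_ (f x + g x)) (sumOver-+ xs f g))
          (interchange (f x) (g x) (sumOver xs f) (sumOver xs g))
    where
    interchange : ∀ a b c d → (a + b) + (c + d) ≡ (a + c) + (b + d)
    interchange = solve-∀

  sumOver-map : ∀ {B : Set} (h : A → B) (xs : List A) f → sumOver (map h xs) f ≡ sumOver xs (f ∘ h)
  sumOver-map h []       f = refl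
  sumOver-map h (x ∷ xs) f = cong (_+_ (f (h x))) (sumOver-map h xs f)

  alt-foldr : ∀ k (t : A → Poly2) (xs : List A) →
              alt k (foldr (λ x acc → t x +P acc) 0P xs) ≡ sumOver xs (λ x → alt k (t x))
  alt-foldr k t []       = alt-0P k
  alt-foldr k t (x ∷ xs) = trans (alt-+P k (t x) _) (cong (_+_ (alt k (t x))) (alt-foldr k t xs))

sumOver-allSubsets-suc : ∀ n (f : Subset (suc n) → ℤ) →
  sumOver (allSubsets (suc n)) f ≡ sumOver (allSubsets n) (λ A → f (inside ∷ A) + f (outside ∷ A))
sumOver-allSubsets-suc n f = begin
  sumOver (map (inside ∷_) subsets ++ map (outside ∷_) subsets) f
    ≡⟨ sumOver-++ (map (inside ∷_) subsets) _ f ⟩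
  sumOver (map (inside ∷_) subsets) f + sumOver (map (outside ∷_) subsets) f
    ≡⟨ cong₂ _+_ (sumOver-map (inside ∷_) subsets f) (sumOver-map (outside ∷_) subsets f) ⟩
  sumOver subsets (f ∘ (inside ∷_)) + sumOver subsets (f ∘ (outside ∷_))
    ≡⟨ sumOver-+ subsets (f ∘ (inside ∷_)) (f ∘ (outside ∷_)) ⟨
  sumOver subsets (λ A → f (inside ∷ A) + f (outside ∷ A)) ∎
  where
  open ≡-Reasoning
  subsets = allSubsets n

σ : ℕ → ℤ → ℕ → ℤ
σ n ρ k = sumOver (allSubsets n) (λ A → ν k (ρ - + ∣ A ∣))

σ-suc : ∀ n ρ k → σ (suc n) ρ k ≡ sumOver (allSubsets n) (λ A → ν k (ρ - + 1 - + ∣ A ∣) + ν k (+ 1 + (ρ - + 1 - + ∣ A ∣)))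
σ-suc n ρ k =
  trans (sumOver-allSubsets-suc n (λ A → ν k (ρ - + ∣ A ∣)))
        (sumOver-cong (allSubsets n) (λ A → cong₂ _+_ (cong (ν k) (shift₁ ρ (+ ∣ A ∣)))
                                                        (cong (ν k) (shift₂ ρ (+ ∣ A ∣)))))
  where
  shift₁ : ∀ r s → r - (+ 1 + s) ≡ r - + 1 - s
  shift₁ = solve-∀
  shift₂ : ∀ r s → r - s ≡ + 1 + (r - + 1 - s)
  shift₂ = solve-∀

σ-suc-suc : ∀ n ρ k → σ (suc n) ρ (suc k) ≡ σ n (ρ - + 1) k
σ-suc-suc n ρ k = trans (σ-suc n ρ (suc k)) (sumOver-cong (allSubsets n) (λ A → ν-pair-suc k (ρ - + 1 - + ∣ A ∣)))

σ-suc-zero : ∀ n ρ → σ (suc n) ρ 0 ≡ + 0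
σ-suc-zero n ρ = trans (σ-suc n ρ 0) (sumOver-zero (allSubsets n) (λ A → ν-pair-zero (ρ - + 1 - + ∣ A ∣)))

σ-below : ∀ {k n} ρ → k < n → σ n ρ k ≡ + 0
σ-below {zero}  {suc n} ρ _         = σ-suc-zero n ρ
σ-below {suc k} {suc n} ρ (s≤s k<n) = trans (σ-suc-suc n ρ k) (σ-below (ρ - + 1) k<n)

σ-diagonal : ∀ n ρ → σ n ρ n ≡ sgn ℤ.∣ + n - ρ ∣
σ-diagonal zero    ρ = begin
  ν 0 (ρ - + 0) + + 0        ≡⟨ ℤP.+-identityʳ _ ⟩
  ν 0 (ρ - + 0)              ≡⟨ ν-zero (ρ - + 0) ⟩
  sgn ℤ.∣ ρ - + 0 ∣          ≡⟨ cong sgn (ℤP.∣-i∣≡∣i∣ (ρ - + 0)) ⟨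
  sgn ℤ.∣ - (ρ - + 0) ∣      ≡⟨ cong (sgn ∘ ℤ.∣_∣) (negate ρ) ⟩
  sgn ℤ.∣ + 0 - ρ ∣          ∎
  where
  open ≡-Reasoning
  negate : ∀ r → - (r - + 0) ≡ + 0 - r
  negate = solve-∀
σ-diagonal (suc n) ρ =
  trans (σ-suc-suc n ρ n) (trans (σ-diagonal n (ρ - + 1)) (cong (sgn ∘ ℤ.∣_∣) (shift (+ n) ρ)))
  where
  shift : ∀ m r → m - (r - + 1) ≡ + 1 + m - r
  shift = solve-∀

altSum≡σ : ∀ {n} (G : RankedSet n) k → altSum G k ≡ σ n (RankedSet.r G ⊤) k
altSum≡σ {n} G k =
  trans (alt-foldr k (λ A → monomial ℤ.∣ r ⊤ - r A ∣ ℤ.∣ + ∣ A ∣ - r A ∣) (allSubsets n))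
        (sumOver-cong (allSubsets n) alt-term)
  where
  open RankedSet G
  alt-term : ∀ A → alt k (monomial ℤ.∣ r ⊤ - r A ∣ ℤ.∣ + ∣ A ∣ - r A ∣) ≡ ν k (r ⊤ - + ∣ A ∣)
  alt-term A = let a = ℤ.∣ r ⊤ - r A ∣; c = ℤ.∣ + ∣ A ∣ - r A ∣ in begin
    alt k (monomial ℤ.∣ r ⊤ - r A ∣ ℤ.∣ + ∣ A ∣ - r A ∣)
      ≡⟨ alt-monomial k a c ⟩
    ν k (ℤ.∣ r ⊤ - r A ∣ ⊖ ℤ.∣ + ∣ A ∣ - r A ∣)
      ≡⟨ cong (ν k) (ℤP.m-n≡m⊖n a c) ⟨
    ν k (+ ℤ.∣ r ⊤ - r A ∣ - + ℤ.∣ + ∣ A ∣ - r A ∣)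
      ≡⟨ cong₂ (λ u v → ν k (u - v)) (ℤP.0≤i⇒+∣i∣≡i (ℤP.i≤j⇒0≤j-i (R1 A)))
                                      (ℤP.0≤i⇒+∣i∣≡i (ℤP.i≤j⇒0≤j-i (R2 A))) ⟩
    ν k ((r ⊤ - r A) - (+ ∣ A ∣ - r A))
      ≡⟨ cong (ν k) (cancel (r ⊤) (r A) (+ ∣ A ∣)) ⟩
    ν k (r ⊤ - + ∣ A ∣) ∎
    where
    open ≡-Reasoning
    cancel : ∀ ρ x s → (ρ - x) - (s - x) ≡ ρ - s
    cancel = solve-∀

theorem3p1 : (n : ℕ) (G : RankedSet n) →
    ((k : ℕ) → k < n → altSum G k ≡ + 0)
    × (altSum G n ≡ (- (+ 1)) ^ Data.Integer.∣ + n - RankedSet.r G ⊤ ∣)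
theorem3p1 n G =
  (λ k k<n → trans (altSum≡σ G k) (σ-below ρ k<n)) ,
  trans (altSum≡σ G n) (σ-diagonal n ρ)
  where
  ρ = RankedSet.r G ⊤
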